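{- Let $H$ be a finite graph and $r,s\ge1$ integers. If $J$ is a minimal and monotone $(r,s)$-protocol for $H$, then $J$ is cautious.
   Context: Discrete-time immunization model. Fix integers $r,s\ge 1$ and a finite graph $H$. An $(r,s)$-protocol for $H$ is a finite sequence $(A_1,\dots,A_N)$ of subsets of $V(H)$ ($A_t$ is the set of vertices immunized at time-step $t$). At time-step $0$ every vertex is red. For each $t\ge 1$ every vertex lies in exactly one of $G_t^r,\dots,G_t^1$ (green), $Y_t^s,\dots,Y_t^1$ (yellow), $R_t$ (red), determined as follows: if $v\in A_t$ then $v\in G_t^r$. If $v\notin A_t$: if $v$ was red at time $t-1$ or $v\in Y_{t-1}^1$, then $v\in R_t$; if $v\in Y_{t-1}^i$ with $2\le i\le s$, then $v\in Y_t^{i-1}$; if $v\in G_{t-1}^i$ with $2\le i\le r$, then $v\in G_t^{i-1}$; if $v\in G_{t-1}^1$ and $v$ has a neighbor in $R_t$, then $v\in Y_t^s$; otherwise $v\in G_t^1$. Let $Y_t=\bigcup_iY_t^i$. The protocol clears $H$ if all vertices are green at time-step $N$. The protocol is minimal if for all $t$ with $1\le t\le N$: whenever $v\in G_t^{\ell}$ and $v\in A_{t+1}$, $v$ has a neighbor in $R_{t+\ell}\cup R_{t+\ell+1}\cup\dots\cup R_{t+r}$. An $(r,s)$-protocol that clears $H$ is monotone if for every $v\in V(H)$: whenever $v\in A_j$, $v\notin R_i$ for all $i>j$. An $(r,s)$-protocol that clears $H$ is cautious if for every vertex $w$: if the first immunization set containing $w$ is $A_j$ and the last is $A_k$, then among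 any $r+s$ consecutive members of $A_j,A_{j+1},\dots,A_k$, at least one contains $w$. -}

module Defs where

open import Data.Nat using (ℕ; zero; suc; _+_; _≤_; _<_; _<?_)
open import Data.Fin using (Fin; fromℕ<)
open import Data.Bool using (Bool; true; false; _∧_; not)
open import Data.List using (allFin)
open import Data.Bool.ListAction using (any)
open import Data.Product using (Σ; _×_; ∃)
open import Relation.Nullary using (yes; no; ¬_)
open import Relation.Binary.PropositionalEquality using (_≡_)

Adj : ℕ → Set
Adj n = Fin n → Fin n → Bool

SymmetricAdj : ∀ {n} → Adj n → Set
SymmetricAdj {n} adj = (u v : Fin n) → adj u v ≡ adj v u

IrreflexiveAdj : ∀ {n} → Adj n → Set
IrreflexiveAdj {n} adj = (v : Fin n) → adj v v ≡ false

data Color : Set where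
  green  : ℕ → Color
  yellow : ℕ → Color
  red    : Color

-- An (r,s)-protocol (A_1,...,A_N): A i is the set A_{i+1} (as a Boolean predicate).
Protocol : ℕ → ℕ → Set
Protocol n N = Fin N → Fin n → Bool

imm : ∀ {n N} → Protocol n N → ℕ → Fin n → Bool
imm {N = N} A zero v = false
imm {N = N} A (suc t) v with t <? N
... | yes p = A (fromℕ< p) v
... | no _  = false

redOrY1 : Color → Bool
redOrY1 red = true
redOrY1 (yellow 1) = true
redOrY1 _ = false

step : ∀ {n} (r s : ℕ) → Adj n → (Fin n → Bool) → (Fin n → Color) → Fin n → Color
step {n} r s adj a prev v with a v
... | true  = green r
... | false = base (prev v)
  where
  redNow : Fin n → Bool
  redNow u = not (a u) ∧ redOrY1 (prev u)
  base : Color → Color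
  base red = red
  base (yellow (suc (suc i))) = yellow (suc i)
  base (yellow _) = red
  base (green (suc (suc i))) = green (suc i)
  base (green _) with any (λ u → adj v u ∧ redNow u) (allFin n)
  ... | true  = yellow s
  ... | false = green 1

-- colouring at time-step t (the dynamics continue with A_t = ∅ for t > N)
state : ∀ {n N} (r s : ℕ) → Adj n → Protocol n N → ℕ → Fin n → Color
state r s adj A zero v = red
state r s adj A (suc t) = step r s adj (imm A (suc t)) (state r s adj A t)

Clears : ∀ {n N} (r s : ℕ) → Adj n → Protocol n N → Set
Clears {n} {N} r s adj A = (v : Fin n) → ∃ λ ℓ → state r s adj A N v ≡ green ℓ

Minimal : ∀ {n N} (r s : ℕ) → Adj n → Protocol n N → Set
Minimal {n} {N} r s adj A =
  (t : ℕ) → 1 ≤ t → t ≤ N → (v : Fin n) (ℓ : ℕ) →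
  state r s adj A t v ≡ green ℓ → imm A (suc t) v ≡ true →
  Σ (Fin n) λ u → adj v u ≡ true ×
    (Σ ℕ λ i → t + ℓ ≤ i × i ≤ t + r × state r s adj A i u ≡ red)

Monotone : ∀ {n N} (r s : ℕ) → Adj n → Protocol n N → Set
Monotone {n} {N} r s adj A =
  Clears r s adj A ×
  ((v : Fin n) (j : ℕ) → 1 ≤ j → j ≤ N → imm A j v ≡ true →
   (i : ℕ) → j < i → i ≤ N → ¬ (state r s adj A i v ≡ red))

Cautious : ∀ {n N} (r s : ℕ) → Adj n → Protocol n N → Set
Cautious {n} {N} r s adj A =
  Clears r s adj A ×
  ((w : Fin n) (j k : ℕ) → 1 ≤ j → k ≤ N →
   imm A j w ≡ true → ((i : ℕ) → i < j → imm A i w ≡ false) →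
   imm A k w ≡ true → ((i : ℕ) → k < i → imm A i w ≡ false) →
   (m : ℕ) → j ≤ m → m + (r + s) ≤ suc k →
   Σ ℕ λ i → m ≤ i × i < m + (r + s) × imm A i w ≡ true)

module Submission where

-- Let w be immunized at p and next at q, with q > p + r + s. The immunity from time p runs
-- out at T₀ = p + r, when w is green with counter 1. By monotonicity (and clearing) a vertex
-- red at some time is red at every earlier time; so a neighbour of w red at any time ≥ T₀
-- is red at T₀ − 1 and at T₀, which turns w yellow at T₀ and red at T₀ + s < q, against
-- monotonicity for w. Hence w stays green until q − 1, while minimality of the immunization
-- at q demands a red neighbour after q − 1. So consecutive immunizations of a vertex are at
-- most r + s apart, and then every window of r + s steps between the first and the last
-- immunization contains one.

open import Defs
open import Data.Nat using (ℕ; zero; suc; _+_; _∸_; _≤_; _<_; _≤‴_; ≤‴-refl; ≤‴-step; z≤n; s≤s; _≤?_; _<?_)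
open import Data.Nat.Properties
open import Data.Fin using (Fin)
open import Data.Bool using (Bool; true; false; _∧_; not; T)
import Data.Bool as Bool
open import Data.Bool.Properties using (¬-not; T-≡; ∧-zeroʳ)
open import Data.Bool.ListAction using (any)
open import Data.List using (allFin)
open import Data.List.Relation.Unary.Any as Any using (satisfied)
open import Data.List.Relation.Unary.Any.Properties using (any⁺; any⁻)
open import Data.List.Membership.Propositional using (_∈_)
open import Data.List.Membership.Propositional.Properties using (∈-allFin)
open import Data.Product using (∃; _×_; _,_; proj₁; proj₂)
open import Data.Sum using (inj₁; inj₂)
open import Data.Empty using (⊥; ⊥-elim)
open import Function using (Equivalence)
open import Relation.Nullary using (¬_; Dec; yes; no; contradiction)
open import Relation.Binary.PropositionalEquality

open Equivalence using (to; from)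

NoneBetween : (ℕ → Bool) → ℕ → ℕ → Set
NoneBetween f a b = ∀ i → a < i → i < b → f i ≡ false

NoneBetween-mono : ∀ {f a a′ b b′} → a ≤ a′ → b′ ≤ b → NoneBetween f a b → NoneBetween f a′ b′
NoneBetween-mono a≤a′ b′≤b none i a′<i i<b′ = none i (≤-<-trans a≤a′ a′<i) (<-≤-trans i<b′ b′≤b)

first-true : (f : ℕ → Bool) {b c : ℕ} → b ≤ c → f c ≡ true →
             ∃ λ q → b ≤ q × q ≤ c × f q ≡ true × (∀ i → b ≤ i → i < q → f i ≡ false)
first-true f {c = c} b≤c fc = search (≤⇒≤‴ b≤c)
  where
  search : ∀ {b} → b ≤‴ c →
           ∃ λ q → b ≤ q × q ≤ c × f q ≡ true × (∀ i → b ≤ i → i < q → f i ≡ false)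
  search {b} b≤c with f b in fb
  ... | true = b , ≤-refl , ≤‴⇒≤ b≤c , fb , λ i b≤i i<b → contradiction b≤i (<⇒≱ i<b)
  search ≤‴-refl | false = contradiction (trans (sym fb) fc) λ ()
  search {b} (≤‴-step b<c) | false with search b<c
  ... | q , b<q , q≤c , fq , before = q , <⇒≤ b<q , q≤c , fq , before′
    where
    before′ : ∀ i → b ≤ i → i < q → f i ≡ false
    before′ i b≤i i<q with m≤n⇒m<n∨m≡n b≤i
    ... | inj₁ b<i = before i b<i i<q
    ... | inj₂ refl = fb

every-window-hit : (f : ℕ → Bool) {L j k : ℕ} → 1 ≤ L →
  (∀ {p q} → p < q → q ≤ k → f p ≡ true → f q ≡ true → NoneBetween f p q → q ≤ p + L) →
  f j ≡ true → f k ≡ true →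
  ∀ m → j ≤ m → m + L ≤ suc k → ∃ λ i → m ≤ i × i < m + L × f i ≡ true
every-window-hit f {L} {j} {k} 1≤L spaced fj fk = hit
  where
  hit : ∀ m → j ≤ m → m + L ≤ suc k → ∃ λ i → m ≤ i × i < m + L × f i ≡ true
  hit m j≤m _ with m≤n⇒m<n∨m≡n j≤m
  ... | inj₂ refl = j , ≤-refl , m<m+n j 1≤L , fj
  hit (suc m) _ window | inj₁ j<m+1 with hit m (≤-pred j<m+1) (≤-trans (n≤1+n _) window)
  ... | i , m≤i , i<m+L , fi with m≤n⇒m<n∨m≡n m≤i
  ...   | inj₁ m<i = i , m<i , m<n⇒m<1+n i<m+L , fi
  ...   | inj₂ refl with first-true f m+1≤k fk
    where
    m+1≤k : suc m ≤ k
    m+1≤k = ≤-trans (subst (_≤ m + L) (+-comm m 1) (+-monoʳ-≤ m 1≤L)) (≤-pred window)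
  ...     | q , m<q , q≤k , fq , before = q , m<q , s≤s (spaced m<q q≤k fi fq before) , fq

any-false : ∀ {A : Set} (p : A → Bool) xs → (∀ x → p x ≡ false) → any p xs ≡ false
any-false p xs none = ¬-not λ some → let (x , px) = satisfied (any⁻ p xs (from T-≡ some)) in
  subst T (none x) px

any-true : ∀ {A : Set} (p : A → Bool) {xs x} → x ∈ xs → p x ≡ true → any p xs ≡ true
any-true p x∈xs px = to T-≡ (any⁺ p (Any.map (λ { refl → from T-≡ px }) x∈xs))

true-∧-not-∧ : ∀ {x y z} → x ∧ (not y ∧ z) ≡ true → x ≡ true × y ≡ false × z ≡ true
true-∧-not-∧ {true} {false} {true} refl = refl , refl , refl

data Decaying : (ℕ → Color) → Set where
  green  : Decaying green
  yellow : Decaying yellow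

module Step {n : ℕ} (r s : ℕ) (adj : Adj n) (a : Fin n → Bool) (prev : Fin n → Color) where
  threatens : Fin n → Fin n → Bool
  threatens v u = adj v u ∧ (not (a u) ∧ redOrY1 (prev u))

  step-immunized : ∀ {v} → a v ≡ true → step r s adj a prev v ≡ green r
  step-immunized av rewrite av = refl

  step-decays : ∀ {c v i} → Decaying c → a v ≡ false → prev v ≡ c (suc (suc i)) →
                step r s adj a prev v ≡ c (suc i)
  step-decays green av pv rewrite av | pv = refl
  step-decays yellow av pv rewrite av | pv = refl

  step-red : ∀ {v} → a v ≡ false → redOrY1 (prev v) ≡ true → step r s adj a prev v ≡ red
  step-red {v} av h rewrite av with prev v | h
  ... | red | _ = refl
  ... | yellow 1 | _ = refl

  step-safe : ∀ {v ℓ} → a v ≡ false → prev v ≡ green ℓ → ℓ ≤ 1 → (∀ u → threatens v u ≡ false) →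
              step r s adj a prev v ≡ green 1
  step-safe {v} av pv z≤n safe rewrite av | pv | any-false (threatens v) (allFin n) safe = refl
  step-safe {v} av pv (s≤s z≤n) safe rewrite av | pv | any-false (threatens v) (allFin n) safe = refl

  step-threatened : ∀ {v u} → a v ≡ false → prev v ≡ green 1 → threatens v u ≡ true →
                    step r s adj a prev v ≡ yellow s
  step-threatened {v} {u} av pv th rewrite av | pv | any-true (threatens v) (∈-allFin u) th = refl

  unthreatened : ∀ {v u} → redOrY1 (prev u) ≡ false → threatens v u ≡ false
  unthreatened {v} {u} ru rewrite ru | ∧-zeroʳ (not (a u)) = ∧-zeroʳ (adj v u)

  step-red⇒unimmunized : ∀ {v} → step r s adj a prev v ≡ red → a v ≡ false
  step-red⇒unimmunized {v} red-now with a v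
  ... | false = refl

  threat-red-neighbour : ∀ {v u} → threatens v u ≡ true →
                         adj v u ≡ true × step r s adj a prev u ≡ red
  threat-red-neighbour th = let (vu , au , ru) = true-∧-not-∧ th in vu , step-red au ru

red? : (c : Color) → Dec (c ≡ red)
red? red        = yes refl
red? (green _)  = no λ ()
red? (yellow _) = no λ ()

module Dynamics {n N : ℕ} (r s : ℕ) (adj : Adj n) (A : Protocol n N) where
  st : ℕ → Fin n → Color
  st = state r s adj A

  module At (t : ℕ) = Step r s adj (imm A (suc t)) (st t)

  Unimmunized : Fin n → ℕ → ℕ → Set
  Unimmunized v = NoneBetween (λ i → imm A i v)

  imm-after-end : ∀ {t v} → N ≤ t → imm A (suc t) v ≡ false
  imm-after-end {t} N≤t with t <? N
  ... | yes t<N = contradiction N≤t (<⇒≱ t<N)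
  ... | no _    = refl

  immunized⇒positive : ∀ {t v} → imm A t v ≡ true → 1 ≤ t
  immunized⇒positive {suc t} _ = s≤s z≤n

  immunized⇒green : ∀ {t v} → imm A t v ≡ true → st t v ≡ green r
  immunized⇒green {suc t} immT = At.step-immunized t immT

  green-after-end : Clears r s adj A → ∀ e v → ∃ λ ℓ → st (N + e) v ≡ green ℓ
  green-after-end cleared zero v rewrite +-identityʳ N = cleared v
  green-after-end cleared (suc e) v rewrite +-suc N e = stay-green (green-after-end cleared e v)
    where
    idle : imm A (suc (N + e)) v ≡ false
    idle = imm-after-end (m≤m+n N e)
    safe : ∀ u → At.threatens (N + e) v u ≡ false
    safe u = At.unthreatened (N + e) (cong redOrY1 (proj₂ (green-after-end cleared e u)))
    stay-green : (∃ λ ℓ → st (N + e) v ≡ green ℓ) → ∃ λ ℓ → st (suc (N + e)) v ≡ green ℓ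
    stay-green (zero        , g) = 1     , At.step-safe (N + e) idle g z≤n safe
    stay-green (suc zero    , g) = 1     , At.step-safe (N + e) idle g (s≤s z≤n) safe
    stay-green (suc (suc ℓ) , g) = suc ℓ , At.step-decays (N + e) green idle g

  red-before-end : Clears r s adj A → ∀ {t v} → st t v ≡ red → t ≤ N
  red-before-end cleared {t} {v} redT with t ≤? N
  ... | yes t≤N = t≤N
  ... | no  t≰N with green-after-end cleared (t ∸ N) v
  ...   | ℓ , g rewrite m+[n∸m]≡n (<⇒≤ (≰⇒> t≰N)) = contradiction (trans (sym redT) g) λ ()

  unred⇒immunized : ∀ t {v} → ¬ st t v ≡ red → ∃ λ j → 1 ≤ j × j ≤ t × imm A j v ≡ true
  unred⇒immunized zero        unred = contradiction refl unred
  unred⇒immunized (suc t) {v} unred with imm A (suc t) v Bool.≟ true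
  ... | yes immT = suc t , s≤s z≤n , ≤-refl , immT
  ... | no  unimm with unred⇒immunized t (λ redT → unred (At.step-red t (¬-not unimm) (cong redOrY1 redT)))
  ...   | j , 1≤j , j≤t , immJ = j , 1≤j , m≤n⇒m≤1+n j≤t , immJ

  red-downward-closed : Monotone r s adj A → ∀ {i t v} → st i v ≡ red → t ≤ i → st t v ≡ red
  red-downward-closed (cleared , stays-unred) {i} {t} {v} redI t≤i with red? (st t v)
  ... | yes redT = redT
  ... | no unred with unred⇒immunized t unred | m≤n⇒m<n∨m≡n t≤i
  ...   | _ , _ , _ , _ | inj₂ refl = contradiction redI unred
  ...   | j , 1≤j , j≤t , immJ | inj₁ t<i =
          contradiction redI (stays-unred v j 1≤j (≤-trans (<⇒≤ j<i) i≤N) immJ i j<i i≤N)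
    where
    i≤N : i ≤ N
    i≤N = red-before-end cleared redI
    j<i : j < i
    j<i = ≤-<-trans j≤t t<i

  countdown : ∀ {c t v} k {d} → Decaying c → st t v ≡ c (suc (d + k)) →
              Unimmunized v t (suc (t + k)) → st (t + k) v ≡ c (suc d)
  countdown {t = t} zero {d} _ stT _ rewrite +-identityʳ t | +-identityʳ d = stT
  countdown {c} {t} {v} (suc k) {d} decaying stT quiet rewrite +-suc t k =
    countdown k decaying (At.step-decays t decaying idle stT′) quiet′
    where
    stT′ : st t v ≡ c (suc (suc (d + k)))
    stT′ = subst (λ ℓ → st t v ≡ c (suc ℓ)) (+-suc d k) stT
    idle : imm A (suc t) v ≡ false
    idle = quiet (suc t) ≤-refl (s≤s (s≤s (m≤m+n t k)))
    quiet′ : Unimmunized v (suc t) (suc (suc (t + k)))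
    quiet′ = NoneBetween-mono (n≤1+n t) ≤-refl quiet

  yellow-expires : ∀ {t v} k → st t v ≡ yellow (suc k) →
                   Unimmunized v t (suc (suc (t + k))) → st (suc (t + k)) v ≡ red
  yellow-expires {t} k stT quiet =
    At.step-red (t + k) (quiet (suc (t + k)) (s≤s (m≤m+n t k)) ≤-refl)
      (cong redOrY1 (countdown k {0} yellow stT (NoneBetween-mono ≤-refl (n≤1+n _) quiet)))

module Spacing {n N : ℕ} (r′ s′ : ℕ) (adj : Adj n) (A : Protocol n N)
  (minimal : Minimal (suc r′) (suc s′) adj A) (monotone : Monotone (suc r′) (suc s′) adj A) where
  open Dynamics (suc r′) (suc s′) adj A

  module FarApart {w : Fin n} {p q₀ : ℕ} (immP : imm A p w ≡ true) (immQ : imm A (suc q₀) w ≡ true)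
                  (q≤N : suc q₀ ≤ N) (quiet : Unimmunized w p (suc q₀))
                  (far : p + (suc r′ + suc s′) ≤ q₀) where
    T₀ : ℕ
    T₀ = suc (p + r′)

    expiry≤q₀ : suc (T₀ + s′) ≤ q₀
    expiry≤q₀ = subst (_≤ q₀) shift far
      where
      open ≡-Reasoning
      shift : p + (suc r′ + suc s′) ≡ suc (T₀ + s′)
      shift = begin
        p + suc (r′ + suc s′)   ≡⟨ +-suc p (r′ + suc s′) ⟩
        suc (p + (r′ + suc s′)) ≡⟨ cong suc (sym (+-assoc p r′ (suc s′))) ⟩
        suc (p + r′ + suc s′)   ≡⟨ cong suc (+-suc (p + r′) s′) ⟩
        suc (T₀ + s′)           ∎

    T₀≤q₀ : T₀ ≤ q₀
    T₀≤q₀ = ≤-trans (m≤m+n T₀ s′) (<⇒≤ expiry≤q₀)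

    p<T₀ : p < T₀
    p<T₀ = s≤s (m≤m+n p r′)

    unimmunized : ∀ {t} → p < t → t ≤ q₀ → imm A t w ≡ false
    unimmunized p<t t≤q₀ = quiet _ p<t (s≤s t≤q₀)

    green-before-T₀ : st (p + r′) w ≡ green 1
    green-before-T₀ = countdown r′ green (immunized⇒green {p} {w} immP)
                        (NoneBetween-mono ≤-refl (s≤s (<⇒≤ T₀≤q₀)) quiet)

    not-yellow-at-T₀ : ¬ st T₀ w ≡ yellow (suc s′)
    not-yellow-at-T₀ yellowT₀ = proj₂ monotone w p (immunized⇒positive {p} {w} immP) p≤N immP
      (suc (T₀ + s′)) (s≤s (≤-trans (<⇒≤ p<T₀) (m≤m+n T₀ s′))) (≤-trans expiry≤q₀ (<⇒≤ q≤N))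
      (yellow-expires s′ yellowT₀ (NoneBetween-mono (<⇒≤ p<T₀) (s≤s expiry≤q₀) quiet))
      where
      p≤N : p ≤ N
      p≤N = ≤-trans (<⇒≤ p<T₀) (≤-trans T₀≤q₀ (<⇒≤ q≤N))

    no-red-neighbour : ∀ {u t} → adj w u ≡ true → T₀ ≤ t → ¬ st t u ≡ red
    no-red-neighbour {u} wu T₀≤t redT = not-yellow-at-T₀
      (At.step-threatened (p + r′) (unimmunized p<T₀ T₀≤q₀) green-before-T₀ threat)
      where
      threat : At.threatens (p + r′) w u ≡ true
      threat rewrite wu
                   | At.step-red⇒unimmunized (p + r′) (red-downward-closed monotone redT T₀≤t)
                   | red-downward-closed monotone redT (≤-trans (n≤1+n _) T₀≤t) = refl

    green-until : ∀ {t} → p + r′ ≤ t → t ≤ q₀ → st t w ≡ green 1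
    green-until start≤t t≤q₀ with m≤n⇒m<n∨m≡n start≤t
    ... | inj₂ refl = green-before-T₀
    green-until {suc t} _ t<q₀ | inj₁ T₀≤t+1 =
      At.step-safe t (unimmunized (≤-trans p<T₀ T₀≤t+1) t<q₀)
        (green-until (≤-pred T₀≤t+1) (<⇒≤ t<q₀)) (s≤s z≤n) safe
      where
      safe : ∀ u → At.threatens t w u ≡ false
      safe u = ¬-not λ th → let (wu , redU) = At.threat-red-neighbour t th in
        no-red-neighbour wu T₀≤t+1 redU

    absurd : ⊥
    absurd with minimal q₀ (≤-trans (s≤s z≤n) T₀≤q₀) (<⇒≤ q≤N) w 1 (green-until (<⇒≤ T₀≤q₀) ≤-refl) immQ
    ... | u , wu , i , q₀+1≤i , _ , redI =
      no-red-neighbour wu (≤-trans (≤-trans T₀≤q₀ (m≤m+n q₀ 1)) q₀+1≤i) redI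

  immunizations-close : ∀ {w p q} → p < q → q ≤ N → imm A p w ≡ true → imm A q w ≡ true →
                        Unimmunized w p q → q ≤ p + (suc r′ + suc s′)
  immunizations-close {p = p} {suc q₀} _ q≤N immP immQ quiet with suc q₀ ≤? p + (suc r′ + suc s′)
  ... | yes close = close
  ... | no  far   = ⊥-elim (FarApart.absurd immP immQ q≤N quiet (≤-pred (≰⇒> far)))

theorem3p9 : (n : ℕ) (adj : Adj n) → SymmetricAdj adj → IrreflexiveAdj adj →
             (r s : ℕ) → 1 ≤ r → 1 ≤ s → (N : ℕ) (A : Protocol n N) →
             Minimal r s adj A → Monotone r s adj A → Cautious r s adj A
theorem3p9 _ adj _ _ (suc r′) (suc s′) (s≤s z≤n) (s≤s z≤n) _ A minimal monotone =
  proj₁ monotone , λ w j k _ k≤N immJ _ immK _ →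
    every-window-hit (λ i → imm A i w) (s≤s z≤n)
      (λ p<q q≤k → immunizations-close p<q (≤-trans q≤k k≤N)) immJ immK
  where
  open Spacing r′ s′ adj A minimal monotone
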